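{- Define $\tau_0,\tau_1$ on positive integers as follows: if $n=\sum_{j\ge0}\epsilon_jF_{j+2}$ is the Zeckendorf expansion of $n$, then $\tau_0(n)=\sum_{j\ge0}\epsilon_jF_{j+3}$ and $\tau_1(n)=\sum_{j\ge0}\epsilon_jF_{j+3}+F_2$. Then $$\{\tau_0(n):n\ge1\}=\{n\ge1: d(n)\in\{1,2\}\},$$ $$\{\tau_1(n):n\ge1,\ d(n)\in\{1,2\}\}=\{n\ge2: d(n)=0\},$$ $$\{\tau_1(n):n\ge1,\ d(n)=0\}=\{n\ge1: d(n)=2\}.$$ Consequently, $$\{\tau_0(n):n\ge1\}\cup\{\tau_1(n):n\ge1\}=\{n: n\ge2\},\qquad \{\tau_0(n):n\ge1\}\cap\{\tau_1(n):n\ge1\}=\{n\ge1:d(n)=2\}.$$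
   Context: Fibonacci numbers: $F_0=0,F_1=1,F_n=F_{n-1}+F_{n-2}$. Zeckendorf expansion: every positive integer $n$ is uniquely $n=\sum_{j\ge0}\epsilon_jF_{j+2}$ with $\epsilon_j\in\{0,1\}$, finitely many nonzero, $\epsilon_j\epsilon_{j+1}=0$. Let $k(n)=\min\{j:\epsilon_j=1\}$ and set $d(n)=0$ if $k(n)=0$, $d(n)=1$ if $k(n)$ is odd, $d(n)=2$ if $k(n)$ is even and $\ge2$. -}

module Defs where

open import Data.Nat using (ℕ; zero; suc; _+_; _%_; _≤_)
open import Data.Bool using (Bool; true; false)
open import Data.List using (List; []; _∷_)
open import Data.Product using (∃; _×_)
open import Data.Sum using (_⊎_)
open import Relation.Binary.PropositionalEquality using (_≡_)

F : ℕ → ℕ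
F zero = 0
F (suc zero) = 1
F (suc (suc n)) = F (suc n) + F n

-- A digit string ε = ε₀ ε₁ ε₂ … (head is ε₀).
-- valFrom o ε = Σ_j ε_j F (j + o)
valFrom : ℕ → List Bool → ℕ
valFrom o [] = 0
valFrom o (true ∷ ε) = F o + valFrom (suc o) ε
valFrom o (false ∷ ε) = valFrom (suc o) ε

data NoAdjOnes : List Bool → Set where
  nil   : NoAdjOnes []
  one   : NoAdjOnes (true ∷ [])
  oneZ  : ∀ {ε} → NoAdjOnes (false ∷ ε) → NoAdjOnes (true ∷ false ∷ ε)
  zer   : ∀ {ε} → NoAdjOnes ε → NoAdjOnes (false ∷ ε)

IsZeck : List Bool → ℕ → Set
IsZeck ε n = NoAdjOnes ε × valFrom 2 ε ≡ n

-- k = min { j : ε_j = 1 } (junk value on the all-zero string, which never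
-- occurs for expansions of positive integers)
lowIdx : List Bool → ℕ
lowIdx [] = 0
lowIdx (true ∷ ε) = 0
lowIdx (false ∷ ε) = suc (lowIdx ε)

dFromK : ℕ → ℕ
dFromK zero = 0
dFromK (suc k) with suc k % 2
... | zero = 2
... | suc _ = 1

-- D n c : "d(n) = c", read through the (unique) Zeckendorf expansion of n
D : ℕ → ℕ → Set
D n c = ∃ λ ε → IsZeck ε n × dFromK (lowIdx ε) ≡ c

Tau0 : ℕ → ℕ → Set
Tau0 n m = ∃ λ ε → IsZeck ε n × m ≡ valFrom 3 ε

Tau1 : ℕ → ℕ → Set
Tau1 n m = ∃ λ ε → IsZeck ε n × m ≡ valFrom 3 ε + F 2

Img0 : ℕ → Set
Img0 m = ∃ λ n → 1 ≤ n × Tau0 n m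

Img1 : ℕ → Set
Img1 m = ∃ λ n → 1 ≤ n × Tau1 n m

-- An expansion ε of n gives the expansion 0ε of τ₀(n), whose lowest one has index ≥ 1, so d ≠ 0;
-- conversely stripping a leading 0 inverts τ₀. Adding F₂ to τ₀(n) puts a one at index 0 when
-- the lowest one of 0ε has index ≥ 2, giving d = 0. When d(n) = 0 it meets the one at index 1,
-- and F_j + F_{j+1} = F_{j+2} carries it upward two places at a time, so the lowest one of the
-- result ends at an even index ≥ 2; this carry is invertible. Since the top one of an expansion
-- of n sits at the k with F_k ≤ n < F_{k+1}, expansions are unique up to trailing zeros, so τ₀,
-- τ₁ and d are well defined on positive integers, and the last two identities follow from the
-- first three.
module Submission where

open import Defs
open import Data.Nat using (ℕ; zero; suc; _+_; _≤_; _<_; _≤′_; ≤′-refl; ≤′-step; z≤n; s≤s)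
open import Data.Nat.Properties
open import Data.Bool using (Bool; true; false)
open import Data.List using (List; []; _∷_; _++_; _∷ʳ_; length; initLast; _∷ʳ′_)
open import Data.List.Properties using (length-++)
open import Data.List.Relation.Unary.All using (All; []; _∷_)
import Data.List.Relation.Unary.All.Properties as All
open import Data.Product using (∃; _×_; _,_; proj₂)
open import Data.Sum using (_⊎_; inj₁; inj₂; [_,_]′)
open import Data.Empty using (⊥; ⊥-elim)
open import Function.Bundles using (_⇔_; mk⇔)
open import Relation.Binary.PropositionalEquality

F-≤-suc : ∀ p → F p ≤ F (suc p)
F-≤-suc zero    = z≤n
F-≤-suc (suc p) = m≤m+n (F (suc p)) (F p)

F-mono : ∀ {m n} → m ≤ n → F m ≤ F n
F-mono m≤n = go (≤⇒≤′ m≤n)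
  where
  go : ∀ {m n} → m ≤′ n → F m ≤ F n
  go ≤′-refl            = ≤-refl
  go (≤′-step {n} m≤′n) = ≤-trans (go m≤′n) (F-≤-suc n)

F-positive : ∀ p → 1 ≤ F (suc p)
F-positive zero    = s≤s z≤n
F-positive (suc p) = ≤-trans (F-positive p) (m≤m+n _ _)

F-carry : ∀ o v → F (suc (suc o)) + v ≡ F o + (F (suc o) + v)
F-carry o v = trans (cong (_+ v) (+-comm (F (suc o)) (F o))) (+-assoc (F o) (F (suc o)) v)

valFrom-++ : ∀ o xs ys → valFrom o (xs ++ ys) ≡ valFrom o xs + valFrom (o + length xs) ys
valFrom-++ o [] ys = cong (λ p → valFrom p ys) (sym (+-identityʳ o))
valFrom-++ o (true ∷ xs) ys rewrite valFrom-++ (suc o) xs ys | +-suc o (length xs) =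
  sym (+-assoc (F o) _ _)
valFrom-++ o (false ∷ xs) ys rewrite valFrom-++ (suc o) xs ys | +-suc o (length xs) = refl

valFrom-∷ʳ-false : ∀ o xs → valFrom o (xs ∷ʳ false) ≡ valFrom o xs
valFrom-∷ʳ-false o xs = trans (valFrom-++ o xs _) (+-identityʳ _)

valFrom-∷ʳ-true : ∀ o xs → valFrom o (xs ∷ʳ true) ≡ valFrom o xs + F (o + length xs)
valFrom-∷ʳ-true o xs = trans (valFrom-++ o xs _) (cong (valFrom o xs +_) (+-identityʳ _))

length-∷ʳ : ∀ xs (x : Bool) → length (xs ∷ʳ x) ≡ suc (length xs)
length-∷ʳ xs x = trans (length-++ xs) (+-comm (length xs) 1)

length<length-∷ʳ : ∀ xs (x : Bool) → length xs < length (xs ∷ʳ x)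
length<length-∷ʳ xs x = ≤-reflexive (sym (length-∷ʳ xs x))

All-false⇒valFrom≡0 : ∀ o {ε} → All (_≡ false) ε → valFrom o ε ≡ 0
All-false⇒valFrom≡0 o []          = refl
All-false⇒valFrom≡0 o (refl ∷ zs) = All-false⇒valFrom≡0 (suc o) zs

valFrom≡0⇒All-false : ∀ o ε → valFrom (suc o) ε ≡ 0 → All (_≡ false) ε
valFrom≡0⇒All-false o []          _ = []
valFrom≡0⇒All-false o (false ∷ ε) e = refl ∷ valFrom≡0⇒All-false (suc o) ε e
valFrom≡0⇒All-false o (true ∷ ε)  e = ⊥-elim (>⇒≢ (≤-trans (F-positive o) (m≤m+n _ _)) e)

valFrom-positive-shift : ∀ o o' ε → 1 ≤ valFrom (suc o) ε → 1 ≤ valFrom (suc o') ε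
valFrom-positive-shift o o' (true ∷ ε)  _ = ≤-trans (F-positive o') (m≤m+n _ _)
valFrom-positive-shift o o' (false ∷ ε) p = valFrom-positive-shift (suc o) (suc o') ε p

NoAdjOnes-++⁻ˡ : ∀ xs {ys} → NoAdjOnes (xs ++ ys) → NoAdjOnes xs
NoAdjOnes-++⁻ˡ []                  _         = nil
NoAdjOnes-++⁻ˡ (true ∷ [])         _         = one
NoAdjOnes-++⁻ˡ (true ∷ false ∷ xs) (oneZ na) = oneZ (NoAdjOnes-++⁻ˡ (false ∷ xs) na)
NoAdjOnes-++⁻ˡ (false ∷ xs)        (zer na)  = zer (NoAdjOnes-++⁻ˡ xs na)

NoAdjOnes-∷⁻ : ∀ {x ε} → NoAdjOnes (x ∷ ε) → NoAdjOnes ε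
NoAdjOnes-∷⁻ one      = nil
NoAdjOnes-∷⁻ (oneZ p) = p
NoAdjOnes-∷⁻ (zer p)  = p

valFrom-bound : ∀ p {ε} → NoAdjOnes ε → valFrom (suc p) ε + F p ≤ F (suc p + length ε)
valFrom-bound p nil = F-mono (≤-trans (n≤1+n p) (m≤m+n (suc p) 0))
valFrom-bound p one =
  ≤-reflexive (trans (cong (_+ F p) (+-identityʳ _)) (cong F (+-comm 1 (suc p))))
valFrom-bound p (oneZ (zer {r} na)) = begin
  (F (suc p) + valFrom (3 + p) r) + F p  ≡⟨ +-comm (F (suc p) + _) (F p) ⟩
  F p + (F (suc p) + valFrom (3 + p) r)  ≡⟨ F-carry p _ ⟨
  F (2 + p) + valFrom (3 + p) r          ≡⟨ +-comm (F (2 + p)) _ ⟩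
  valFrom (3 + p) r + F (2 + p)          ≤⟨ valFrom-bound (2 + p) na ⟩
  F (3 + p + length r)                   ≡⟨ cong (λ n → F (suc n)) (+-suc-suc p (length r)) ⟨
  F (suc p + length (true ∷ false ∷ r))  ∎
  where
  open ≤-Reasoning
  +-suc-suc : ∀ m n → m + suc (suc n) ≡ suc (suc (m + n))
  +-suc-suc m n = trans (+-suc m (suc n)) (cong suc (+-suc m n))
valFrom-bound p (zer {r} na) = begin
  valFrom (2 + p) r + F p        ≤⟨ +-monoʳ-≤ (valFrom (2 + p) r) (F-≤-suc p) ⟩
  valFrom (2 + p) r + F (suc p)  ≤⟨ valFrom-bound (suc p) na ⟩
  F (2 + p + length r)           ≡⟨ cong (λ n → F (suc n)) (+-suc p (length r)) ⟨
  F (suc p + length (false ∷ r)) ∎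
  where open ≤-Reasoning

∷ʳ-true-length-≤ : ∀ q xs ys → NoAdjOnes (xs ∷ʳ true) →
  valFrom (2 + q) (ys ∷ʳ true) ≤ valFrom (2 + q) (xs ∷ʳ true) → length ys ≤ length xs
∷ʳ-true-length-≤ q xs ys na le = ≮⇒≥ λ xs<ys → <-irrefl refl (begin-strict
  F (o + length (xs ∷ʳ true))        ≤⟨ F-mono (+-monoʳ-≤ o (length-∷ʳ≤ xs<ys)) ⟩
  F (o + length ys)                  ≤⟨ m≤n+m _ (valFrom o ys) ⟩
  valFrom o ys + F (o + length ys)   ≡⟨ valFrom-∷ʳ-true o ys ⟨
  valFrom o (ys ∷ʳ true)             ≤⟨ le ⟩
  valFrom o (xs ∷ʳ true)             <⟨ m<m+n _ (F-positive q) ⟩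
  valFrom o (xs ∷ʳ true) + F (suc q) ≤⟨ valFrom-bound (suc q) na ⟩
  F (o + length (xs ∷ʳ true))        ∎)
  where
  open ≤-Reasoning
  o = 2 + q
  length-∷ʳ≤ : length xs < length ys → length (xs ∷ʳ true) ≤ length ys
  length-∷ʳ≤ = ≤-trans (≤-reflexive (length-∷ʳ xs true))

∷ʳ-true-length-unique : ∀ q xs ys → NoAdjOnes (xs ∷ʳ true) → NoAdjOnes (ys ∷ʳ true) →
  valFrom (2 + q) (xs ∷ʳ true) ≡ valFrom (2 + q) (ys ∷ʳ true) → length xs ≡ length ys
∷ʳ-true-length-unique q xs ys na na' e =
  ≤-antisym (∷ʳ-true-length-≤ q ys xs na' (≤-reflexive e))
            (∷ʳ-true-length-≤ q xs ys na (≤-reflexive (sym e)))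

-- Equality of digit strings up to trailing zeros.
infix 4 _≈_

data _≈_ : List Bool → List Bool → Set where
  zeros : ∀ {a b} → All (_≡ false) a → All (_≡ false) b → a ≈ b
  _∷_   : ∀ x {a b} → a ≈ b → x ∷ a ≈ x ∷ b

≈-refl : ∀ a → a ≈ a
≈-refl []      = zeros [] []
≈-refl (x ∷ a) = x ∷ ≈-refl a

≈-sym : ∀ {a b} → a ≈ b → b ≈ a
≈-sym (zeros za zb) = zeros zb za
≈-sym (x ∷ a≈b)     = x ∷ ≈-sym a≈b

≈-∷ʳ-false : ∀ {a b} → a ≈ b → a ∷ʳ false ≈ b
≈-∷ʳ-false (zeros za zb) = zeros (All.∷ʳ⁺ za refl) zb
≈-∷ʳ-false (x ∷ a≈b)     = x ∷ ≈-∷ʳ-false a≈b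

≈∧length⇒≡ : ∀ {a b} → a ≈ b → length a ≡ length b → a ≡ b
≈∧length⇒≡ (zeros za zb) = all-false za zb
  where
  all-false : ∀ {a b} → All (_≡ false) a → All (_≡ false) b → length a ≡ length b → a ≡ b
  all-false []          []          _ = refl
  all-false (refl ∷ za) (refl ∷ zb) e = cong (false ∷_) (all-false za zb (suc-injective e))
≈∧length⇒≡ (x ∷ a≈b) e = cong (x ∷_) (≈∧length⇒≡ a≈b (suc-injective e))

≈-valFrom : ∀ o {a b} → a ≈ b → valFrom o a ≡ valFrom o b
≈-valFrom o (zeros za zb) = trans (All-false⇒valFrom≡0 o za) (sym (All-false⇒valFrom≡0 o zb))
≈-valFrom o (true ∷ a≈b)  = cong (F o +_) (≈-valFrom (suc o) a≈b)
≈-valFrom o (false ∷ a≈b) = ≈-valFrom (suc o) a≈b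

≈-lowIdx : ∀ o {a b} → a ≈ b → 1 ≤ valFrom (suc o) a → lowIdx a ≡ lowIdx b
≈-lowIdx o (zeros za _) pos  = ⊥-elim (>⇒≢ pos (All-false⇒valFrom≡0 (suc o) za))
≈-lowIdx o (true ∷ _) _      = refl
≈-lowIdx o (false ∷ a≈b) pos = cong suc (≈-lowIdx (suc o) a≈b pos)

-- Induction on the top digit, with fuel N bounding the total length.
equal-valFrom⇒≈ : ∀ N q ε ε' → length ε + length ε' < N → NoAdjOnes ε → NoAdjOnes ε' →
  valFrom (2 + q) ε ≡ valFrom (2 + q) ε' → ε ≈ ε'
equal-valFrom⇒≈ (suc N) q ε ε' fuel na na' e with initLast ε | initLast ε'
... | []             | _  = zeros [] (valFrom≡0⇒All-false (suc q) ε' (sym e))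
... | xs ∷ʳ′ _       | [] = zeros (valFrom≡0⇒All-false (suc q) _ e) []
... | xs ∷ʳ′ false   | _  = ≈-∷ʳ-false (equal-valFrom⇒≈ N q xs ε'
      (<-≤-trans (+-monoˡ-< (length ε') (length<length-∷ʳ xs false)) (≤-pred fuel))
      (NoAdjOnes-++⁻ˡ xs na) na' (trans (sym (valFrom-∷ʳ-false _ xs)) e))
... | xs ∷ʳ′ true    | ys ∷ʳ′ false = ≈-sym (≈-∷ʳ-false (≈-sym (equal-valFrom⇒≈ N q (xs ∷ʳ true) ys
      (<-≤-trans (+-monoʳ-< (length (xs ∷ʳ true)) (length<length-∷ʳ ys false)) (≤-pred fuel))
      na (NoAdjOnes-++⁻ˡ ys na') (trans e (valFrom-∷ʳ-false _ ys)))))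
... | xs ∷ʳ′ true    | ys ∷ʳ′ true  =
      subst (λ zs → xs ∷ʳ true ≈ zs ∷ʳ true) (≈∧length⇒≡ xs≈ys same-length) (≈-refl _)
  where
  o = 2 + q
  same-length : length xs ≡ length ys
  same-length = ∷ʳ-true-length-unique q xs ys na na' e
  same-value : valFrom o xs ≡ valFrom o ys
  same-value = +-cancelʳ-≡ (F (o + length ys)) _ _ (begin
    valFrom o xs + F (o + length ys) ≡⟨ cong (λ l → valFrom o xs + F (o + l)) same-length ⟨
    valFrom o xs + F (o + length xs) ≡⟨ valFrom-∷ʳ-true o xs ⟨
    valFrom o (xs ∷ʳ true)           ≡⟨ e ⟩
    valFrom o (ys ∷ʳ true)           ≡⟨ valFrom-∷ʳ-true o ys ⟩
    valFrom o ys + F (o + length ys) ∎)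
    where open ≡-Reasoning
  xs≈ys : xs ≈ ys
  xs≈ys = equal-valFrom⇒≈ N q xs ys
    (<-≤-trans (+-mono-< (length<length-∷ʳ xs true) (length<length-∷ʳ ys true)) (≤-pred fuel))
    (NoAdjOnes-++⁻ˡ xs na) (NoAdjOnes-++⁻ˡ ys na') same-value

Zeck-unique : ∀ {ε ε' n} → IsZeck ε n → IsZeck ε' n → ε ≈ ε'
Zeck-unique {ε} {ε'} (na , e) (na' , e') =
  equal-valFrom⇒≈ _ 0 ε ε' ≤-refl na na' (trans e (sym e'))

dFromK-suc : ∀ k → dFromK (suc k) ≡ 1 ⊎ dFromK (suc k) ≡ 2
dFromK-suc zero          = inj₁ refl
dFromK-suc (suc zero)    = inj₂ refl
dFromK-suc (suc (suc k)) = dFromK-suc k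

dFromK-suc≢0 : ∀ k → dFromK (suc k) ≢ 0
dFromK-suc≢0 zero          ()
dFromK-suc≢0 (suc zero)    ()
dFromK-suc≢0 (suc (suc k)) = dFromK-suc≢0 k

dFromK-2+ : ∀ k → dFromK k ≡ 2 → dFromK (2 + k) ≡ 2
dFromK-2+ (suc k) d≡2 = d≡2

-- F o + F (o + 1) = F (o + 2) carries upward two places at a time, so the lowest one
-- of the result lands at an even index ≥ 2.
carry : ∀ o r → NoAdjOnes (true ∷ r) → ∃ λ δ → NoAdjOnes δ ×
  valFrom o δ ≡ F o + valFrom (suc o) (true ∷ r) × dFromK (lowIdx δ) ≡ 2
carry o [] one =
  false ∷ false ∷ true ∷ [] , zer (zer one) , F-carry o 0 , refl
carry o (false ∷ []) (oneZ (zer nil)) =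
  false ∷ false ∷ true ∷ [] , zer (zer one) , F-carry o 0 , refl
carry o (false ∷ false ∷ t) (oneZ (zer na)) =
  false ∷ false ∷ true ∷ false ∷ t , zer (zer (oneZ na)) , F-carry o _ , refl
carry o (false ∷ true ∷ t) (oneZ (zer na)) with carry (2 + o) t na
... | δ , nδ , e , d≡2 =
  false ∷ false ∷ δ , zer (zer nδ) , trans e (F-carry o _) , dFromK-2+ (lowIdx δ) d≡2

-- Positivity excludes all-zero strings, whose junk lowIdx (their length) may be even.
uncarry : ∀ o δ → NoAdjOnes δ → 1 ≤ valFrom o δ → dFromK (lowIdx δ) ≡ 2 →
  ∃ λ r → NoAdjOnes (true ∷ r) × valFrom o δ ≡ F o + valFrom (suc o) (true ∷ r)
uncarry o (false ∷ false ∷ true ∷ s) (zer (zer na)) _ _ =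
  false ∷ s , oneZ (zer (NoAdjOnes-∷⁻ na)) , F-carry o _
uncarry o (false ∷ false ∷ false ∷ s) (zer (zer na)) pos d≡2
  with uncarry (2 + o) (false ∷ s) na pos d≡2
... | r , nr , e = false ∷ true ∷ r , oneZ (zer nr) , trans e (F-carry o _)

add-F : ∀ o s → NoAdjOnes s → ∃ λ δ → NoAdjOnes δ × valFrom o δ ≡ F o + valFrom (suc o) s
add-F o []          nil      = true ∷ [] , one , refl
add-F o (false ∷ s) (zer na) = true ∷ false ∷ s , oneZ (zer na) , refl
add-F o (true ∷ s)  na with carry o s na
... | δ , nδ , e , _ = δ , nδ , e

Zeck-exists : ∀ n → ∃ λ ε → IsZeck ε n
Zeck-exists zero = [] , nil , refl
Zeck-exists (suc n) with Zeck-exists n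
... | [] , nil , e = true ∷ [] , one , cong suc e
... | false ∷ s , zer na , e with add-F 2 s na
...   | δ , nδ , e' = δ , nδ , trans e' (cong suc e)
Zeck-exists (suc n) | true ∷ [] , one , e = false ∷ true ∷ [] , zer one , cong suc e
Zeck-exists (suc n) | true ∷ false ∷ t , oneZ (zer na) , e with add-F 3 t na
... | δ , nδ , e' = false ∷ δ , zer nδ , trans e' (cong suc e)

D≢0 : ℕ → Set
D≢0 n = D n 1 ⊎ D n 2

leading-zero⇒D≢0 : ∀ {ε n} → IsZeck (false ∷ ε) n → D≢0 n
leading-zero⇒D≢0 {ε} z with dFromK-suc (lowIdx ε)
... | inj₁ d≡1 = inj₁ (false ∷ ε , z , d≡1)
... | inj₂ d≡2 = inj₂ (false ∷ ε , z , d≡2)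

D≢0⇒leading-zero : ∀ {n} → D≢0 n → ∃ λ ε → IsZeck (false ∷ ε) n
D≢0⇒leading-zero = [ leading-zero , leading-zero ]′
  where
  leading-zero : ∀ {n c} → D n (suc c) → ∃ λ ε → IsZeck (false ∷ ε) n
  leading-zero (false ∷ ε , z , _) = ε , z

D0⇒leading-one : ∀ {n} → 1 ≤ n → D n 0 → ∃ λ ε → IsZeck (true ∷ ε) n
D0⇒leading-one () ([] , (_ , refl) , _)
D0⇒leading-one _  (true ∷ ε , z , _)    = ε , z
D0⇒leading-one _  (false ∷ ε , _ , d≡0) = ⊥-elim (dFromK-suc≢0 (lowIdx ε) d≡0)

D-total : ∀ n → D n 0 ⊎ D≢0 n
D-total n with Zeck-exists n
... | []        , z = inj₁ ([] , z , refl)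
... | true ∷ ε  , z = inj₁ (true ∷ ε , z , refl)
... | false ∷ ε , z = inj₂ (leading-zero⇒D≢0 z)

D-functional : ∀ {n c c'} → 1 ≤ n → D n c → D n c' → c ≡ c'
D-functional pos (ε , zε@(_ , e) , refl) (ε' , zε' , refl) =
  cong dFromK (≈-lowIdx 1 (Zeck-unique zε zε') (subst (1 ≤_) (sym e) pos))

D0-D≢0-disjoint : ∀ {n} → 1 ≤ n → D n 0 → D≢0 n → ⊥
D0-D≢0-disjoint pos d0 (inj₁ d1) with D-functional pos d0 d1
... | ()
D0-D≢0-disjoint pos d0 (inj₂ d2) with D-functional pos d0 d2
... | ()

D≢0⇒2≤ : ∀ {n} → 1 ≤ n → D≢0 n → 2 ≤ n
D≢0⇒2≤ {suc zero}    pos d = ⊥-elim (D0-D≢0-disjoint pos (true ∷ [] , (one , refl) , refl) d)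
D≢0⇒2≤ {suc (suc n)} _   _ = s≤s (s≤s z≤n)

Tau1⇒2≤ : ∀ {n m} → 1 ≤ n → Tau1 n m → 2 ≤ m
Tau1⇒2≤ pos (ε , (_ , e) , refl) =
  +-monoˡ-≤ 1 (valFrom-positive-shift 1 2 ε (subst (1 ≤_) (sym e) pos))

Img0⇒D≢0 : ∀ {m} → Img0 m → 1 ≤ m × D≢0 m
Img0⇒D≢0 (n , pos , ε , (na , e) , refl) =
  valFrom-positive-shift 1 2 ε (subst (1 ≤_) (sym e) pos) , leading-zero⇒D≢0 (zer na , refl)

D≢0⇒Img0 : ∀ {m} → 1 ≤ m × D≢0 m → Img0 m
D≢0⇒Img0 (pos , d) with D≢0⇒leading-zero d
... | ε , zer na , e =
  valFrom 2 ε , valFrom-positive-shift 2 1 ε (subst (1 ≤_) (sym e) pos) , ε , (na , refl) , sym e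

Tau1-D≢0⇒D0 : ∀ {m} → (∃ λ n → 1 ≤ n × D≢0 n × Tau1 n m) → 2 ≤ m × D m 0
Tau1-D≢0⇒D0 (n , pos , d , t@(ε , zε , refl)) with D≢0⇒leading-zero d
... | r , zr@(na , _) = Tau1⇒2≤ pos t , (true ∷ false ∷ r , (oneZ na , value) , refl)
  where
  value : valFrom 2 (true ∷ false ∷ r) ≡ valFrom 3 ε + F 2
  value = trans (+-comm (F 2) _) (cong (_+ F 2) (≈-valFrom 3 (Zeck-unique zr zε)))

D0⇒Tau1-D≢0 : ∀ {m} → 2 ≤ m × D m 0 → ∃ λ n → 1 ≤ n × D≢0 n × Tau1 n m
D0⇒Tau1-D≢0 (2≤m , d0) with D0⇒leading-one (≤-trans (n≤1+n 1) 2≤m) d0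
... | []        , (_ , refl) with 2≤m
...   | s≤s ()
D0⇒Tau1-D≢0 (2≤m , d0) | false ∷ s , (oneZ na , refl) =
  valFrom 3 s , valFrom-positive-shift 3 2 s (≤-pred 2≤m) , leading-zero⇒D≢0 (na , refl) ,
  false ∷ s , (na , refl) , +-comm (F 2) _

Tau1-D0⇒D2 : ∀ {m} → (∃ λ n → 1 ≤ n × D n 0 × Tau1 n m) → 1 ≤ m × D m 2
Tau1-D0⇒D2 (n , pos , d0 , ε , zε , refl) with D0⇒leading-one pos d0
... | r , zr@(na , _) with carry 2 r na
...   | δ , nδ , e , d≡2 = m≤n+m 1 _ , δ , (nδ , value) , d≡2
  where
  value : valFrom 2 δ ≡ valFrom 3 ε + F 2
  value = trans e (trans (+-comm (F 2) _) (cong (_+ F 2) (≈-valFrom 3 (Zeck-unique zr zε))))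

D2⇒Tau1-D0 : ∀ {m} → 1 ≤ m × D m 2 → ∃ λ n → 1 ≤ n × D n 0 × Tau1 n m
D2⇒Tau1-D0 (pos , δ , (nδ , e) , d≡2) with uncarry 2 δ nδ (subst (1 ≤_) (sym e) pos) d≡2
... | r , nr , e' =
  valFrom 2 (true ∷ r) , s≤s z≤n , (true ∷ r , (nr , refl) , refl) ,
  true ∷ r , (nr , refl) , trans (sym e) (trans e' (+-comm (F 2) _))

Img⇒2≤ : ∀ {m} → Img0 m ⊎ Img1 m → 2 ≤ m
Img⇒2≤ (inj₁ img0)          = let pos , d = Img0⇒D≢0 img0 in D≢0⇒2≤ pos d
Img⇒2≤ (inj₂ (n , pos , t)) = Tau1⇒2≤ pos t

2≤⇒Img : ∀ {m} → 2 ≤ m → Img0 m ⊎ Img1 m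
2≤⇒Img {m} 2≤m with D-total m
... | inj₁ d0 = let n , pos , _ , t = D0⇒Tau1-D≢0 (2≤m , d0) in inj₂ (n , pos , t)
... | inj₂ d  = inj₁ (D≢0⇒Img0 (≤-trans (n≤1+n 1) 2≤m , d))

Img0∧Img1⇒D2 : ∀ {m} → Img0 m × Img1 m → 1 ≤ m × D m 2
Img0∧Img1⇒D2 (img0 , n , pos , t) with Img0⇒D≢0 img0 | D-total n
... | _     , _  | inj₁ d0 = Tau1-D0⇒D2 (n , pos , d0 , t)
... | pos-m , dm | inj₂ d  =
  ⊥-elim (D0-D≢0-disjoint pos-m (proj₂ (Tau1-D≢0⇒D0 (n , pos , d , t))) dm)

D2⇒Img0∧Img1 : ∀ {m} → 1 ≤ m × D m 2 → Img0 m × Img1 m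
D2⇒Img0∧Img1 (pos , d2) =
  let n , pos-n , _ , t = D2⇒Tau1-D0 (pos , d2) in D≢0⇒Img0 (pos , inj₂ d2) , (n , pos-n , t)

proposition6 :
    (∀ m → Img0 m ⇔ (1 ≤ m × (D m 1 ⊎ D m 2)))
    × (∀ m → (∃ λ n → 1 ≤ n × (D n 1 ⊎ D n 2) × Tau1 n m) ⇔ (2 ≤ m × D m 0))
    × (∀ m → (∃ λ n → 1 ≤ n × D n 0 × Tau1 n m) ⇔ (1 ≤ m × D m 2))
    × (∀ m → (Img0 m ⊎ Img1 m) ⇔ 2 ≤ m)
    × (∀ m → (Img0 m × Img1 m) ⇔ (1 ≤ m × D m 2))
proposition6 =
  (λ m → mk⇔ Img0⇒D≢0 D≢0⇒Img0) ,
  (λ m → mk⇔ Tau1-D≢0⇒D0 D0⇒Tau1-D≢0) ,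
  (λ m → mk⇔ Tau1-D0⇒D2 D2⇒Tau1-D0) ,
  (λ m → mk⇔ Img⇒2≤ 2≤⇒Img) ,
  (λ m → mk⇔ Img0∧Img1⇒D2 D2⇒Img0∧Img1)
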